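{- Let $G$ be a graph and $R\subseteq V(G)$ with $|R|\ge 2$. If $G$ has an $R$-CIST of size $2$, then there is a directed $R$-minor of $G$ that has a CISA of size $2$.
   Context: Graphs are finite and connected, may have parallel edges but no loops. For a (directed or undirected) tree $T$, $\mathrm{int}(T)$ is the set of vertices of degree at least 2 in the underlying undirected tree and $L(T)$ the set of leaves. An $R$-Steiner tree is a subtree $T$ of $G$ with $R\subseteq V(T)$ and $L(T)\subseteq R$. An $R$-CIST of size $k$ is a set $\{T_1,\dots,T_k\}$ of $R$-Steiner trees such that for all distinct $u,v\in R$ and distinct $i,j$, the $(u,v)$-paths in $T_i$ and $T_j$ are edge-disjoint and internally vertex-disjoint. Directed $R$-minor: let $\mathcal P=\{V_1,\dots,V_{|R|}\}$ be a partition of $V(G)$ with $|V_i\cap R|=1$ and $G[V_i]$ connected for all $i$; the directed $R$-minor induced by $\mathcal P$ is the digraph with vertex set $\mathcal P$ in which there is an arc $(V_i,V_j)$ ($i\ne j$) for each edge of $G$ joining a vertex of $V_i$ to the terminal in $V_j$. An arborescence is a directed tree in which every vertex except the root (in-degree 0) has in-degree 1 in the tree. A CISA of size $k$ in a digraph $D$ is a set $\{T_1,\dots,T_k\}$ of spanning arborescences of $D$ with $\mathrm{int}(T_i)\cap\mathrm{int}(T_j)=\emptyset$ and $A(T_i)\cap A(T_j)=\emptyset$ for all distinct $i,j$. -}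

module Defs where

open import Data.Nat using (ℕ; _≥_)
open import Data.Fin using (Fin)
open import Data.Fin.Subset using (Subset; _∈_; ∣_∣)
open import Data.Bool using (Bool; true; false)
open import Data.Product using (Σ; _×_; _,_; proj₁; proj₂; ∃)
open import Data.Sum using (_⊎_)
open import Data.List using (List; []; _∷_; drop)
open import Data.List.Relation.Unary.Unique.Propositional using (Unique)
import Data.List.Membership.Propositional as LM
open import Data.Empty using (⊥)
open import Data.Unit using (⊤)
open import Relation.Binary.PropositionalEquality using (_≡_; _≢_)

-- Generic (multi)graph notions, for a vertex type V and an edge index
-- type E with an endpoint map.  For a digraph, ends a = (tail , head).

module _ {V E : Set} (ends : E → V × V) where

  Joins : E → V → V → Set
  Joins e u w = (ends e ≡ (u , w)) ⊎ (ends e ≡ (w , u))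

  data Walk (S : E → Set) : V → V → Set where
    nil  : ∀ v → Walk S v v
    cons : ∀ {u w v} (e : E) → Joins e u w → S e → Walk S w v → Walk S u v

  initVerts : ∀ {S u v} → Walk S u v → List V
  initVerts (nil _) = []
  initVerts {u = u} (cons _ _ _ w) = u ∷ initVerts w

  verts : ∀ {S u v} → Walk S u v → List V
  verts (nil v) = v ∷ []
  verts {u = u} (cons _ _ _ w) = u ∷ verts w

  innerVerts : ∀ {S u v} → Walk S u v → List V
  innerVerts w = drop 1 (initVerts w)

  edgesOf : ∀ {S u v} → Walk S u v → List E
  edgesOf (nil _) = []
  edgesOf (cons e _ _ w) = e ∷ edgesOf w

  IsPath : ∀ {S u v} → Walk S u v → Set
  IsPath w = Unique (verts w)

  IsCycle : ∀ {S u} → Walk S u u → Set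
  IsCycle (nil _) = ⊥
  IsCycle w@(cons _ _ _ _) = Unique (edgesOf w) × Unique (initVerts w)

  record IsTree (VS : V → Set) (ES : E → Set) : Set where
    field
      edgesInside : ∀ e → ES e → VS (proj₁ (ends e)) × VS (proj₂ (ends e))
      nonempty    : Σ V VS
      connected   : ∀ u v → VS u → VS v → Walk ES u v
      acyclic     : ∀ u (w : Walk ES u u) → IsCycle w → ⊥

  DegAtLeast2 : (E → Set) → V → Set
  DegAtLeast2 ES v = Σ E λ e → Σ E λ f → e ≢ f × ES e × ES f
                       × (Σ V (Joins e v)) × (Σ V (Joins f v))

-- Graphs: finite, connected, parallel edges allowed, no loops.

record Graph : Set where
  field
    n      : ℕ
    m      : ℕ
    ends   : Fin m → Fin n × Fin n
    noLoop : ∀ e → proj₁ (ends e) ≢ proj₂ (ends e)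
    conn   : ∀ u v → Walk ends (λ _ → ⊤) u v

module _ (G : Graph) where
  open Graph G

  record Subtree : Set₁ where
    field
      VS   : Fin n → Set
      ES   : Fin m → Set
      tree : IsTree ends VS ES

  -- R-Steiner tree: R ⊆ V(T) and L(T) ⊆ R
  -- (a leaf is a vertex of T of degree ≤ 1, i.e. not of degree ≥ 2)
  record SteinerTree (R : Subset n) : Set₁ where
    field
      T       : Subtree
      covers  : ∀ v → v ∈ R → Subtree.VS T v
      leavesR : ∀ v → Subtree.VS T v → (DegAtLeast2 ends (Subtree.ES T) v → ⊥) → v ∈ R

  PathsDisjoint : (R : Subset n) → SteinerTree R → SteinerTree R → Set
  PathsDisjoint R T₁ T₂ =
    ∀ u v → u ∈ R → v ∈ R → u ≢ v →
    (P : Walk ends (Subtree.ES (SteinerTree.T T₁)) u v) → IsPath ends P →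
    (Q : Walk ends (Subtree.ES (SteinerTree.T T₂)) u v) → IsPath ends Q →
      (∀ e → e LM.∈ edgesOf ends P → e LM.∈ edgesOf ends Q → ⊥)
    × (∀ x → x LM.∈ innerVerts ends P → x LM.∈ innerVerts ends Q → ⊥)

  record CIST2 (R : Subset n) : Set₁ where
    field
      T₁ T₂ : SteinerTree R
      disj₁₂ : PathsDisjoint R T₁ T₂
      disj₂₁ : PathsDisjoint R T₂ T₁

  -- partition of V(G) into k parts (part v = index of the part containing v)
  -- with exactly one terminal per part and each G[V_i] connected
  record RPartition (R : Subset n) : Set where
    field
      k    : ℕ
      part : Fin n → Fin k
      oneTerminal : ∀ i → Σ (Fin n) λ t → t ∈ R × part t ≡ i
                      × (∀ t' → t' ∈ R → part t' ≡ i → t' ≡ t)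
      partConnected : ∀ u v → part u ≡ part v →
        Walk ends (λ e → part (proj₁ (ends e)) ≡ part u
                         × part (proj₂ (ends e)) ≡ part u) u v

  module _ {R : Subset n} (P : RPartition R) where
    open RPartition P

    -- candidate arcs: an edge e of G with an orientation;
    -- true: from the part of the first end to the part of the second,
    -- false: the reverse.
    Arc : Set
    Arc = Fin m × Bool

    src tgtV : Arc → Fin n
    src (e , true)  = proj₁ (ends e)
    src (e , false) = proj₂ (ends e)
    tgtV (e , true)  = proj₂ (ends e)
    tgtV (e , false) = proj₁ (ends e)

    -- (e , d) is an arc of the directed R-minor: e joins a vertex of V_i
    -- to the terminal of V_j with i ≠ j
    IsArc : Arc → Set
    IsArc a = (part (src a) ≢ part (tgtV a)) × tgtV a ∈ R

    arcEnds : Arc → Fin k × Fin k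
    arcEnds a = part (src a) , part (tgtV a)

    record Arborescence : Set₁ where
      field
        AS       : Arc → Set
        arcs     : ∀ a → AS a → IsArc a
        isTree   : IsTree arcEnds (λ _ → ⊤) AS
        root     : Fin k
        rootIn0  : ∀ a → AS a → proj₂ (arcEnds a) ≢ root
        inDeg1   : ∀ v → v ≢ root → Σ Arc λ a → AS a × proj₂ (arcEnds a) ≡ v
        inDeg≤1  : ∀ a b → AS a → AS b → proj₂ (arcEnds a) ≡ proj₂ (arcEnds b) → a ≡ b

    record CISA2 : Set₁ where
      field
        A₁ A₂   : Arborescence
        arcDisj : ∀ a → Arborescence.AS A₁ a → Arborescence.AS A₂ a → ⊥
        intDisj : ∀ v → DegAtLeast2 arcEnds (Arborescence.AS A₁) v
                      → DegAtLeast2 arcEnds (Arborescence.AS A₂) v → ⊥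

-- Root T₂ at any terminal and let r₁ be a terminal farthest from that root: r₁ is an inner
-- vertex of no T₂-path between terminals.  Likewise root T₁ at r₁ and pick r₂ ≠ r₁ that is an
-- inner vertex of no T₁-path between terminals.  The core of Tᵢ is the union of its
-- terminal-to-rᵢ paths.  If some vertex is inner on a terminal path in T₁ and on one in T₂,
-- splitting these paths at further terminals produces a single pair of terminals whose T₁- and
-- T₂-paths both pass through it, contradicting the CIST property; so the two cores share only
-- terminals.  Every vertex then descends to a terminal, towards rᵢ inside the core of Tᵢ and by
-- breadth-first search towards the cores elsewhere; the fibres of this descent are the parts.
-- In the minor, each terminal t ≠ rᵢ receives the arc given by its parent edge in Tᵢ, whose
-- source part belongs to a terminal strictly closer to rᵢ; this gives an arborescence rooted at
-- the part of rᵢ.  A common arc would be an edge of both trees or would leave a non-terminal of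
-- both cores, and a part interior to both arborescences has a terminal separating terminals in
-- both trees (or equal to r₁ or r₂); all of this is excluded above.

module Submission where

open import Defs
open import Data.Bool using (Bool; true; false)
open import Data.Empty using (⊥; ⊥-elim)
open import Data.Fin using (Fin; _≟_; toℕ; fromℕ<) renaming (zero to fzero; suc to fsuc)
open import Data.Fin.Properties using (any?; toℕ-fromℕ<)
open import Data.Fin.Subset using (Subset; inside; outside; ∣_∣) renaming (_∈_ to _∈ˢ_; _∉_ to _∉ˢ_)
open import Data.Fin.Subset.Properties using (_∈?_)
open import Data.List using (List; []; _∷_; _++_; length; map; allFin)
open import Data.List.Extrema.Nat using (max; xs≤max; argmax; f[xs]≤f[argmax])
open import Data.List.Membership.Propositional using (_∈_; _∉_)
open import Data.List.Membership.Propositional.Properties using (∈-++⁻; ∈-map⁺; ∈-allFin)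
import Data.List.Membership.DecPropositional as DecMembership
open import Data.List.Relation.Binary.Subset.Propositional using (_⊆_)
import Data.List.Relation.Unary.All as All
open import Data.List.Relation.Unary.All using ([]; _∷_)
open import Data.List.Relation.Unary.All.Properties.Core using (¬Any⇒All¬)
open import Data.List.Relation.Unary.AllPairs using ([]; _∷_)
open import Data.List.Relation.Unary.Any using (here; there)
open import Data.List.Relation.Unary.Unique.Propositional using (Unique)
open import Data.List.Relation.Unary.Unique.Propositional.Properties using (Unique[x∷xs]⇒x∉xs; ++⁺)
open import Data.Maybe using (Maybe; just; nothing)
open import Data.Maybe.Properties using (just-injective)
open import Data.Nat using (ℕ; zero; suc; pred; _+_; _≤_; _<_; _≥_; _≤′_; ≤′-refl; ≤′-step; z≤n; s≤s; >-nonZero)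
open import Data.Nat.Properties
  using ( ≤-refl; ≤-reflexive; ≤-trans; <-trans; ≤-<-trans; <-≤-trans; <-irrefl; <⇒≤; ≤-pred; <⇒≤pred
        ; pred[n]≤n; suc-pred; n≤1+n; n≮0; n≤0⇒n≡0; 0≢1+n; m<n⇒0<n; m≤m+n; m≤n+m; +-monoʳ-<; ≤⇒≤′
        ; module ≤-Reasoning)
open import Data.Product using (Σ; ∃; ∃₂; _×_; _,_; proj₁; proj₂)
open import Data.Product.Properties using (≡-dec)
open import Data.Sum using (_⊎_; inj₁; inj₂)
open import Data.Unit using (⊤; tt)
open import Data.Vec.Base using (_∷_; here; there)
open import Relation.Binary.Definitions using (DecidableEquality)
open import Relation.Binary.PropositionalEquality
  using (_≡_; _≢_; refl; sym; trans; cong; cong₂; subst; subst₂; module ≡-Reasoning)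
open import Relation.Nullary using (¬_; Dec; yes; no; contradiction)
open import Relation.Nullary.Decidable using (_×-dec_; _⊎-dec_)
open import Relation.Unary using (Decidable)

module Walks {V E : Set} (ends : E → V × V) where

  joins-sym : ∀ {e u w} → Joins ends e u w → Joins ends e w u
  joins-sym (inj₁ eq) = inj₂ eq
  joins-sym (inj₂ eq) = inj₁ eq

  joins-end : ∀ {e u w a b} → Joins ends e u w → Joins ends e a b → u ≡ a ⊎ u ≡ b
  joins-end (inj₁ p) (inj₁ q) = inj₁ (cong proj₁ (trans (sym p) q))
  joins-end (inj₁ p) (inj₂ q) = inj₂ (cong proj₁ (trans (sym p) q))
  joins-end (inj₂ p) (inj₁ q) = inj₂ (cong proj₂ (trans (sym p) q))
  joins-end (inj₂ p) (inj₂ q) = inj₁ (cong proj₂ (trans (sym p) q))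

  infixr 5 _++ʷ_
  _++ʷ_ : ∀ {S u v w} → Walk ends S u v → Walk ends S v w → Walk ends S u w
  nil _ ++ʷ q = q
  cons e j s p ++ʷ q = cons e j s (p ++ʷ q)

  reverseʷ : ∀ {S u v} → Walk ends S u v → Walk ends S v u
  reverseʷ (nil v) = nil v
  reverseʷ (cons e j s p) = reverseʷ p ++ʷ cons e (joins-sym j) s (nil _)

  mapʷ : ∀ {S S′ : E → Set} {u v} → (∀ {e} → S e → S′ e) → Walk ends S u v → Walk ends S′ u v
  mapʷ f (nil v) = nil v
  mapʷ f (cons e j s p) = cons e j (f s) (mapʷ f p)

  restrictʷ : ∀ {S S′ : E → Set} {u v} (p : Walk ends S u v) → (∀ {e} → e ∈ edgesOf ends p → S′ e) →
              Walk ends S′ u v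
  restrictʷ (nil v) f = nil v
  restrictʷ (cons e j s p) f = cons e j (f (here refl)) (restrictʷ p (λ m → f (there m)))

  length-restrictʷ : ∀ {S S′ : E → Set} {u v} (p : Walk ends S u v) (f : ∀ {e} → e ∈ edgesOf ends p → S′ e) →
                     length (edgesOf ends (restrictʷ p f)) ≡ length (edgesOf ends p)
  length-restrictʷ (nil v) f = refl
  length-restrictʷ (cons e j s p) f = cong suc (length-restrictʷ p (λ m → f (there m)))

  edge∈walk⇒S : ∀ {S u v} (p : Walk ends S u v) {e} → e ∈ edgesOf ends p → S e
  edge∈walk⇒S (cons e j s p) (here refl) = s
  edge∈walk⇒S (cons e j s p) (there m) = edge∈walk⇒S p m

  start∈verts : ∀ {S u v} (p : Walk ends S u v) → u ∈ verts ends p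
  start∈verts (nil _) = here refl
  start∈verts (cons _ _ _ _) = here refl

  ∈-verts-++ʷ⁻ : ∀ {S u v w} (p : Walk ends S u v) (q : Walk ends S v w) {x} →
                 x ∈ verts ends (p ++ʷ q) → x ∈ verts ends p ⊎ x ∈ verts ends q
  ∈-verts-++ʷ⁻ (nil _) q m = inj₂ m
  ∈-verts-++ʷ⁻ (cons e j s p) q (here refl) = inj₁ (here refl)
  ∈-verts-++ʷ⁻ (cons e j s p) q (there m) with ∈-verts-++ʷ⁻ p q m
  ... | inj₁ m′ = inj₁ (there m′)
  ... | inj₂ m′ = inj₂ m′

  edges-++ʷ : ∀ {S u v w} (p : Walk ends S u v) (q : Walk ends S v w) →
              edgesOf ends (p ++ʷ q) ≡ edgesOf ends p ++ edgesOf ends q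
  edges-++ʷ (nil _) q = refl
  edges-++ʷ (cons e j s p) q = cong (e ∷_) (edges-++ʷ p q)

  ∈-edges-++ʷ⁻ : ∀ {S u v w} (p : Walk ends S u v) (q : Walk ends S v w) {e} →
                 e ∈ edgesOf ends (p ++ʷ q) → e ∈ edgesOf ends p ⊎ e ∈ edgesOf ends q
  ∈-edges-++ʷ⁻ p q {e} m = ∈-++⁻ (edgesOf ends p) (subst (e ∈_) (edges-++ʷ p q) m)

  ∈-verts-reverseʷ⁻ : ∀ {S u v} (p : Walk ends S u v) {x} →
                      x ∈ verts ends (reverseʷ p) → x ∈ verts ends p
  ∈-verts-reverseʷ⁻ (nil _) m = m
  ∈-verts-reverseʷ⁻ (cons e j s p) m with ∈-verts-++ʷ⁻ (reverseʷ p) (cons e (joins-sym j) s (nil _)) m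
  ... | inj₁ m′ = there (∈-verts-reverseʷ⁻ p m′)
  ... | inj₂ (here refl) = there (start∈verts p)
  ... | inj₂ (there (here refl)) = here refl

  ∈-edges-reverseʷ⁻ : ∀ {S u v} (p : Walk ends S u v) {e} →
                      e ∈ edgesOf ends (reverseʷ p) → e ∈ edgesOf ends p
  ∈-edges-reverseʷ⁻ (nil _) ()
  ∈-edges-reverseʷ⁻ (cons e j s p) m with ∈-edges-++ʷ⁻ (reverseʷ p) (cons e (joins-sym j) s (nil _)) m
  ... | inj₁ m′ = there (∈-edges-reverseʷ⁻ p m′)
  ... | inj₂ (here refl) = here refl

  endpoint∈verts : ∀ {S u v} (p : Walk ends S u v) {e x y} → e ∈ edgesOf ends p →
                   Joins ends e x y → x ∈ verts ends p
  endpoint∈verts (cons e j s p) (here refl) j′ with joins-end j′ j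
  ... | inj₁ refl = here refl
  ... | inj₂ refl = there (start∈verts p)
  endpoint∈verts (cons e j s p) (there m) j′ = there (endpoint∈verts p m j′)

  path-edges-unique : ∀ {S u v} (p : Walk ends S u v) → IsPath ends p → Unique (edgesOf ends p)
  path-edges-unique (nil _) _ = []
  path-edges-unique (cons e j s p) (u∉p ∷ up) =
    ¬Any⇒All¬ _ (λ m → Unique[x∷xs]⇒x∉xs (u∉p ∷ up) (endpoint∈verts p m j)) ∷ path-edges-unique p up

  ∈-initVerts : ∀ {S u v} (p : Walk ends S u v) {x} → x ∈ verts ends p → x ≢ v →
                x ∈ initVerts ends p
  ∈-initVerts (nil _) (here refl) x≢v = ⊥-elim (x≢v refl)
  ∈-initVerts (cons e j s p) (here refl) _ = here refl
  ∈-initVerts (cons e j s p) (there m) x≢v = there (∈-initVerts p m x≢v)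

  inner-vertex : ∀ {S u v} (p : Walk ends S u v) {x} → x ∈ verts ends p → x ≢ u → x ≢ v →
                 x ∈ innerVerts ends p
  inner-vertex (nil _) (here refl) x≢u _ = ⊥-elim (x≢u refl)
  inner-vertex (cons e j s p) (here refl) x≢u _ = ⊥-elim (x≢u refl)
  inner-vertex (cons e j s p) (there m) _ x≢v = ∈-initVerts p m x≢v

  vertex-on-edge : ∀ {S u v} (p : Walk ends S u v) {x} → x ∈ verts ends p →
                   x ≡ u ⊎ Σ E λ e → e ∈ edgesOf ends p × Σ V (Joins ends e x)
  vertex-on-edge (nil _) (here refl) = inj₁ refl
  vertex-on-edge (cons e j s p) (here refl) = inj₁ refl
  vertex-on-edge (cons e j s p) (there m) with vertex-on-edge p m
  ... | inj₁ refl = inj₂ (e , here refl , _ , joins-sym j)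
  ... | inj₂ (f , f∈p , y , j′) = inj₂ (f , there f∈p , y , j′)

  record PathIn {S : E → Set} {u v : V} (w : Walk ends S u v) (x : V) : Set where
    constructor pathIn
    field
      path   : Walk ends S x v
      isPath : IsPath ends path
      verts⊆ : verts ends path ⊆ verts ends w
      edges⊆ : edgesOf ends path ⊆ edgesOf ends w

  suffix : ∀ {S u v} (p : Walk ends S u v) → IsPath ends p → ∀ {x} → x ∈ verts ends p → PathIn p x
  suffix p@(nil _) pp (here refl) = pathIn p pp (λ m → m) (λ m → m)
  suffix p@(cons _ _ _ _) pp (here refl) = pathIn p pp (λ m → m) (λ m → m)
  suffix (cons e j s p) (_ ∷ pp) (there m) with suffix p pp m
  ... | pathIn q pq vq eq = pathIn q pq (λ z → there (vq z)) (λ z → there (eq z))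

  initVerts-++ʷ-edge : ∀ {S a b c} (q : Walk ends S a b) {e} (j : Joins ends e b c) (s : S e) →
                       initVerts ends (q ++ʷ cons e j s (nil c)) ≡ verts ends q
  initVerts-++ʷ-edge (nil _) j s = refl
  initVerts-++ʷ-edge (cons f j′ s′ q) j s = cong (_ ∷_) (initVerts-++ʷ-edge q j s)

  path-closed-by-edge : ∀ {S a b} (q : Walk ends S a b) {e} (j : Joins ends e b a) (s : S e) →
                        IsPath ends q → e ∉ edgesOf ends q → IsCycle ends (q ++ʷ cons e j s (nil a))
  path-closed-by-edge (nil _) j s _ _ = ([] ∷ []) , ([] ∷ [])
  path-closed-by-edge q@(cons _ _ _ _) j s pq e∉q =
    subst Unique (sym (edges-++ʷ q _))
      (++⁺ (path-edges-unique q pq) ([] ∷ []) λ { (m , here refl) → e∉q m }) ,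
    subst Unique (sym (initVerts-++ʷ-edge q j s)) pq

  record EdgeSplit {S : E → Set} (u v : V) (e : E) : Set where
    constructor edgeSplit
    field
      {a b}   : V
      before  : Walk ends S u a
      joins   : Joins ends e a b
      inS     : S e
      after   : Walk ends S b v
      ∉before : e ∉ edgesOf ends before
      ∉after  : e ∉ edgesOf ends after

  split-at-edge : ∀ {S u v} (p : Walk ends S u v) → Unique (edgesOf ends p) →
                  ∀ {e} → e ∈ edgesOf ends p → EdgeSplit {S} u v e
  split-at-edge (cons f j s p) up (here refl) =
    edgeSplit (nil _) j s p (λ ()) (Unique[x∷xs]⇒x∉xs up)
  split-at-edge (cons f j s p) up@(_ ∷ up′) (there m) with split-at-edge p up′ m
  ... | edgeSplit p₁ j′ s′ p₂ n₁ n₂ = edgeSplit (cons f j s p₁) j′ s′ p₂ ∉before n₂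
    where
    ∉before : _ ∉ f ∷ edgesOf ends p₁
    ∉before (here refl) = Unique[x∷xs]⇒x∉xs up m
    ∉before (there m′) = n₁ m′

  Acyclic : (E → Set) → Set
  Acyclic S = ∀ u (c : Walk ends S u u) → IsCycle ends c → ⊥

  module _ (_≟_ : DecidableEquality V) where

    loop-erase : ∀ {S u v} (w : Walk ends S u v) → PathIn w u
    loop-erase (nil v) = pathIn (nil v) ([] ∷ []) (λ m → m) (λ m → m)
    loop-erase {u = u} (cons e j s w) with loop-erase w
    ... | pathIn q pq vq eq with DecMembership._∈?_ _≟_ u (verts ends q)
    ...   | yes u∈q with suffix q pq u∈q
    ...     | pathIn r pr vr er = pathIn r pr (λ z → there (vq (vr z))) (λ z → there (eq (er z)))
    loop-erase {u = u} (cons e j s w) | pathIn q pq vq eq | no u∉q =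
      pathIn (cons e j s q) (¬Any⇒All¬ _ u∉q ∷ pq) verts⊆ edges⊆
      where
      verts⊆ : verts ends (cons e j s q) ⊆ verts ends (cons e j s w)
      verts⊆ (here refl) = here refl
      verts⊆ (there z) = there (vq z)
      edges⊆ : edgesOf ends (cons e j s q) ⊆ edgesOf ends (cons e j s w)
      edges⊆ (here refl) = here refl
      edges⊆ (there z) = there (eq z)

    module _ (_≟ₑ_ : DecidableEquality E) {S : E → Set} (acyclic : Acyclic S) where

      forest-bridge : ∀ {e a b} → Joins ends e a b → S e → (w : Walk ends S a b) → e ∉ edgesOf ends w → ⊥
      forest-bridge j s w e∉w with loop-erase w
      ... | pathIn q pq _ eq =
        acyclic _ (q ++ʷ cons _ (joins-sym j) s (nil _))
          (path-closed-by-edge q (joins-sym j) s pq (λ m → e∉w (eq m)))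

      path-edges⊆walk-edges : ∀ {u v} (p : Walk ends S u v) → IsPath ends p → (w : Walk ends S u v) →
                              edgesOf ends p ⊆ edgesOf ends w
      path-edges⊆walk-edges p pp w {e} m with DecMembership._∈?_ _≟ₑ_ e (edgesOf ends w)
      ... | yes e∈w = e∈w
      ... | no e∉w with split-at-edge p (path-edges-unique p pp) m
      ... | edgeSplit p₁ j s p₂ n₁ n₂ =
        ⊥-elim (forest-bridge j s (reverseʷ p₁ ++ʷ w ++ʷ reverseʷ p₂) avoids)
        where
        avoids : e ∉ edgesOf ends (reverseʷ p₁ ++ʷ w ++ʷ reverseʷ p₂)
        avoids m′ with ∈-edges-++ʷ⁻ (reverseʷ p₁) (w ++ʷ reverseʷ p₂) m′
        ... | inj₁ m₁ = n₁ (∈-edges-reverseʷ⁻ p₁ m₁)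
        ... | inj₂ m₂ with ∈-edges-++ʷ⁻ w (reverseʷ p₂) m₂
        ... | inj₁ m₃ = e∉w m₃
        ... | inj₂ m₄ = n₂ (∈-edges-reverseʷ⁻ p₂ m₄)

      path-verts⊆walk-verts : ∀ {u v} (p : Walk ends S u v) → IsPath ends p → (w : Walk ends S u v) →
                              verts ends p ⊆ verts ends w
      path-verts⊆walk-verts p pp w m with vertex-on-edge p m
      ... | inj₁ refl = start∈verts w
      ... | inj₂ (e , e∈p , _ , j) = endpoint∈verts w (path-edges⊆walk-edges p pp w e∈p) j

-- The least k ≤ b with P k, and b itself if there is none.
least : {P : ℕ → Set} → ((k : ℕ) → Dec (P k)) → ℕ → ℕ
least P? zero = zero
least P? (suc b) with P? zero
... | yes _ = zero
... | no _ = suc (least (λ k → P? (suc k)) b)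

least-holds : ∀ {P : ℕ → Set} (P? : (k : ℕ) → Dec (P k)) b → P b → P (least P? b)
least-holds P? zero p = p
least-holds P? (suc b) p with P? zero
... | yes p₀ = p₀
... | no _ = least-holds (λ k → P? (suc k)) b p

least-≤ : ∀ {P : ℕ → Set} (P? : (k : ℕ) → Dec (P k)) b {ℓ} → P ℓ → least P? b ≤ ℓ
least-≤ P? zero p = z≤n
least-≤ P? (suc b) {ℓ} p with P? zero
least-≤ P? (suc b) {ℓ} p | yes _ = z≤n
least-≤ P? (suc b) {zero} p | no ¬p₀ = contradiction p ¬p₀
least-≤ P? (suc b) {suc ℓ} p | no _ = s≤s (least-≤ (λ k → P? (suc k)) b p)

maxOver : ∀ {n} → (Fin n → ℕ) → ℕ
maxOver {n} f = max 0 (map f (allFin n))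

≤-maxOver : ∀ {n} (f : Fin n → ℕ) i → f i ≤ maxOver f
≤-maxOver {n} f i = All.lookup (xs≤max 0 (map f (allFin n))) (∈-map⁺ f (∈-allFin i))

index : ∀ {k} {R : Subset k} {x} → x ∈ˢ R → Fin ∣ R ∣
index {R = inside ∷ R} here = fzero
index {R = inside ∷ R} (there p) = fsuc (index p)
index {R = outside ∷ R} (there p) = index p

element : ∀ {k} (R : Subset k) → Fin ∣ R ∣ → Fin k
element (inside ∷ R) fzero = fzero
element (inside ∷ R) (fsuc i) = fsuc (element R i)
element (outside ∷ R) i = fsuc (element R i)

element-∈ : ∀ {k} (R : Subset k) i → element R i ∈ˢ R
element-∈ (inside ∷ R) fzero = here
element-∈ (inside ∷ R) (fsuc i) = there (element-∈ R i)
element-∈ (outside ∷ R) i = there (element-∈ R i)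

element-index : ∀ {k} {R : Subset k} {x} (p : x ∈ˢ R) → element R (index p) ≡ x
element-index {R = inside ∷ R} here = refl
element-index {R = inside ∷ R} (there p) = cong fsuc (element-index p)
element-index {R = outside ∷ R} (there p) = cong fsuc (element-index p)

index-element : ∀ {k} (R : Subset k) i → index (element-∈ R i) ≡ i
index-element (inside ∷ R) fzero = refl
index-element (inside ∷ R) (fsuc i) = cong fsuc (index-element R i)
index-element (outside ∷ R) i = index-element R i

∈-irrelevant : ∀ {k} {R : Subset k} {x} (p q : x ∈ˢ R) → p ≡ q
∈-irrelevant here here = refl
∈-irrelevant (there p) (there q) = cong there (∈-irrelevant p q)

index-cong : ∀ {k} {R : Subset k} {x y} → x ≡ y → (p : x ∈ˢ R) (q : y ∈ˢ R) → index p ≡ index q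
index-cong refl p q = cong index (∈-irrelevant p q)

index-injective : ∀ {k} {R : Subset k} {x y} (p : x ∈ˢ R) (q : y ∈ˢ R) → index p ≡ index q → x ≡ y
index-injective p q eq = trans (sym (element-index p)) (trans (cong (element _) eq) (element-index q))

two-elements : ∀ {k} (R : Subset k) → 2 ≤ ∣ R ∣ →
               Σ (Fin k) λ x → Σ (Fin k) λ y → x ∈ˢ R × y ∈ˢ R × x ≢ y
two-elements R 2≤∣R∣ =
  element R i₀ , element R i₁ , element-∈ R i₀ , element-∈ R i₁ , distinct
  where
  i₀ i₁ : Fin ∣ R ∣
  i₀ = fromℕ< {0} (≤-trans (n≤1+n 1) 2≤∣R∣)
  i₁ = fromℕ< {1} 2≤∣R∣
  distinct : element R i₀ ≢ element R i₁
  distinct eq with trans (sym (index-element R i₀)) (trans (index-cong eq (element-∈ R i₀) (element-∈ R i₁)) (index-element R i₁))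
  ... | i₀≡i₁ = 0≢1+n (trans (sym (toℕ-fromℕ< _)) (trans (cong toℕ i₀≡i₁) (toℕ-fromℕ< 2≤∣R∣)))

distinct-from : ∀ {k} {R : Subset k} {x y} → x ∈ˢ R → y ∈ˢ R → x ≢ y → ∀ z → Σ (Fin k) λ w → w ∈ˢ R × w ≢ z
distinct-from {x = x} {y} x∈R y∈R x≢y z with x ≟ z
... | yes refl = y , y∈R , λ y≡x → x≢y (sym y≡x)
... | no x≢z = x , x∈R , x≢z

module BreadthFirst {n m : ℕ} (ends : Fin m → Fin n × Fin n)
                    {S : Fin m → Set} (S? : Decidable S) {X : Fin n → Set} (X? : Decidable X)
                    (bound : ℕ) where

  open Walks ends

  StepInto : (Fin n → Set) → Fin n → Set
  StepInto P y = ∃₂ λ e z → S e × Joins ends e y z × P z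

  joins? : ∀ e y z → Dec (Joins ends e y z)
  joins? e y z = ends e ≟² (y , z) ⊎-dec ends e ≟² (z , y)
    where _≟²_ = ≡-dec _≟_ _≟_

  stepInto? : ∀ {P} → Decidable P → Decidable (StepInto P)
  stepInto? P? y = any? λ e → any? λ z → S? e ×-dec joins? e y z ×-dec P? z

  Reaches : ℕ → Fin n → Set
  Reaches zero = X
  Reaches (suc ℓ) y = Reaches ℓ y ⊎ StepInto (Reaches ℓ) y

  reaches? : ∀ ℓ → Decidable (Reaches ℓ)
  reaches? zero = X?
  reaches? (suc ℓ) y = reaches? ℓ y ⊎-dec stepInto? (reaches? ℓ) y

  reaches-mono : ∀ {ℓ ℓ′ y} → ℓ ≤ ℓ′ → Reaches ℓ y → Reaches ℓ′ y
  reaches-mono ℓ≤ℓ′ = go (≤⇒≤′ ℓ≤ℓ′)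
    where
    go : ∀ {ℓ ℓ′ y} → ℓ ≤′ ℓ′ → Reaches ℓ y → Reaches ℓ′ y
    go ≤′-refl r = r
    go (≤′-step ℓ≤′ℓ′) r = inj₁ (go ℓ≤′ℓ′ r)

  walk-reaches : ∀ {y z} (w : Walk ends S y z) → X z → Reaches (length (edgesOf ends w)) y
  walk-reaches (nil _) x = x
  walk-reaches (cons e j s w) x = inj₂ (e , _ , s , j , walk-reaches w x)

  dist : Fin n → ℕ
  dist y = least (λ ℓ → reaches? ℓ y) bound

  dist-spec : ∀ {y} → Reaches bound y → Reaches (dist y) y
  dist-spec {y} = least-holds (λ ℓ → reaches? ℓ y) bound

  dist-min : ∀ {y ℓ} → Reaches ℓ y → dist y ≤ ℓ
  dist-min {y} = least-≤ (λ ℓ → reaches? ℓ y) bound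

  parent? : ∀ y → Dec (StepInto (Reaches (pred (dist y))) y)
  parent? y = stepInto? (reaches? (pred (dist y))) y

  chosenEdge : ∀ {P y} → Dec (StepInto P y) → Maybe (Fin m)
  chosenEdge (yes (e , _)) = just e
  chosenEdge (no _) = nothing

  chosenTarget : ∀ {P y} → Dec (StepInto P y) → Fin n
  chosenTarget (yes (_ , z , _)) = z
  chosenTarget {y = y} (no _) = y

  record ChosenStep {P y} (d : Dec (StepInto P y)) : Set where
    field
      edge        : Fin m
      chosenEdge≡ : chosenEdge d ≡ just edge
      inS         : S edge
      joins       : Joins ends edge y (chosenTarget d)
      target∈     : P (chosenTarget d)

  chosen-step : ∀ {P y} (d : Dec (StepInto P y)) → StepInto P y → ChosenStep d
  chosen-step (yes (e , z , s , j , p)) _ = record { edge = e ; chosenEdge≡ = refl ; inS = s ; joins = j ; target∈ = p }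
  chosen-step (no ¬p) p = ⊥-elim (¬p p)

  -- Junk values nothing and y at vertices without a parent (in X, or not reaching X within bound).
  nextEdge : Fin n → Maybe (Fin m)
  nextEdge y = chosenEdge (parent? y)

  next : Fin n → Fin n
  next y = chosenTarget (parent? y)

  module _ {y : Fin n} (r : Reaches bound y) (¬x : ¬ X y) where

    pred-dist< : pred (dist y) < dist y
    pred-dist< with dist y | dist-spec r
    ... | zero | x = ⊥-elim (¬x x)
    ... | suc ℓ | _ = s≤s ≤-refl

    parent-exists : StepInto (Reaches (pred (dist y))) y
    parent-exists with dist y | dist-spec r | dist-min {y}
    ... | zero | x | _ = ⊥-elim (¬x x)
    ... | suc ℓ | inj₁ rℓ | min = ⊥-elim (<-irrefl refl (min rℓ))
    ... | suc ℓ | inj₂ s | _ = s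

    parentEdge : ChosenStep (parent? y)
    parentEdge = chosen-step (parent? y) parent-exists

    dist-next : dist (next y) < dist y
    dist-next = ≤-<-trans (dist-min (ChosenStep.target∈ parentEdge)) pred-dist<

    next-reaches : Reaches bound (next y)
    next-reaches = reaches-mono (≤-trans pred[n]≤n (dist-min r)) (ChosenStep.target∈ parentEdge)

module Separation {G : Graph} {R : Subset (Graph.n G)} where
  open Graph G
  open Walks ends

  treeEdges : SteinerTree G R → Fin m → Set
  treeEdges T = Subtree.ES (SteinerTree.T T)

  Separates : SteinerTree G R → Fin n → Fin n → Fin n → Set
  Separates T y a b = y ≢ a × y ≢ b × ((w : Walk ends (treeEdges T) a b) → y ∈ verts ends w)

  module InTree (T : SteinerTree G R) where
    open SteinerTree T using (covers)
    open IsTree (Subtree.tree (SteinerTree.T T)) using (acyclic; connected)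

    private
      erasedConnection : ∀ {a b} (a∈R : a ∈ˢ R) (b∈R : b ∈ˢ R) → PathIn (connected a b (covers a a∈R) (covers b b∈R)) a
      erasedConnection a∈R b∈R = loop-erase _≟_ _

    treePath : ∀ {a b} → a ∈ˢ R → b ∈ˢ R → Walk ends (treeEdges T) a b
    treePath a∈R b∈R = PathIn.path (erasedConnection a∈R b∈R)

    treePath-isPath : ∀ {a b} (a∈R : a ∈ˢ R) (b∈R : b ∈ˢ R) → IsPath ends (treePath a∈R b∈R)
    treePath-isPath a∈R b∈R = PathIn.isPath (erasedConnection a∈R b∈R)

    path-separates : ∀ {y a b} (p : Walk ends (treeEdges T) a b) → IsPath ends p →
                     y ∈ verts ends p → y ≢ a → y ≢ b → Separates T y a b
    path-separates p pp y∈p y≢a y≢b = y≢a , y≢b , λ w → path-verts⊆walk-verts _≟_ _≟_ acyclic p pp w y∈p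

    separates-sym : ∀ {y a b} → Separates T y a b → Separates T y b a
    separates-sym (y≢a , y≢b , on-all) = y≢b , y≢a , λ w → ∈-verts-reverseʷ⁻ w (on-all (reverseʷ w))

    separates-split : ∀ {y a b c} → Separates T y a b → a ∈ˢ R → b ∈ˢ R → c ∈ˢ R → c ≢ y →
                      Separates T y c a ⊎ Separates T y c b
    separates-split {y} (y≢a , y≢b , on-all) a∈R b∈R c∈R c≢y
      with DecMembership._∈?_ _≟_ y (verts ends (treePath c∈R a∈R))
         | DecMembership._∈?_ _≟_ y (verts ends (treePath c∈R b∈R))
    ... | yes y∈p | _ = inj₁ (path-separates _ (treePath-isPath c∈R a∈R) y∈p (λ y≡c → c≢y (sym y≡c)) y≢a)
    ... | no _ | yes y∈q = inj₂ (path-separates _ (treePath-isPath c∈R b∈R) y∈q (λ y≡c → c≢y (sym y≡c)) y≢b)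
    ... | no y∉p | no y∉q = ⊥-elim (avoids (on-all (reverseʷ p ++ʷ q)))
      where
      p = treePath c∈R a∈R
      q = treePath c∈R b∈R
      avoids : y ∉ verts ends (reverseʷ p ++ʷ q)
      avoids m with ∈-verts-++ʷ⁻ (reverseʷ p) q m
      ... | inj₁ y∈p = y∉p (∈-verts-reverseʷ⁻ p y∈p)
      ... | inj₂ y∈q = y∉q y∈q

  module _ (C : CIST2 G R) where
    open CIST2 C
    private
      module T₁ = InTree T₁
      module T₂ = InTree T₂

    ¬separates-same-pair : ∀ {y a b} → Separates T₁ y a b → Separates T₂ y a b → a ∈ˢ R → b ∈ˢ R → ⊥
    ¬separates-same-pair {y} {a} {b} (y≢a , y≢b , on-all₁) (_ , _ , on-all₂) a∈R b∈R with a ≟ b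
    ... | yes refl with on-all₁ (nil a)
    ...   | here y≡a = y≢a y≡a
    ¬separates-same-pair {y} {a} {b} (y≢a , y≢b , on-all₁) (_ , _ , on-all₂) a∈R b∈R | no a≢b =
      proj₂ (disj₁₂ a b a∈R b∈R a≢b P (T₁.treePath-isPath a∈R b∈R) Q (T₂.treePath-isPath a∈R b∈R)) y
        (inner-vertex P (on-all₁ P) y≢a y≢b) (inner-vertex Q (on-all₂ Q) y≢a y≢b)
      where
      P = T₁.treePath a∈R b∈R
      Q = T₂.treePath a∈R b∈R

    ¬separates-shared-end : ∀ {y a b x} → Separates T₁ y a b → Separates T₂ y a x →
                            a ∈ˢ R → b ∈ˢ R → x ∈ˢ R → ⊥
    ¬separates-shared-end S₁@(_ , y≢b , _) S₂@(_ , y≢x , _) a∈R b∈R x∈R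
      with T₂.separates-split S₂ a∈R x∈R b∈R (λ b≡y → y≢b (sym b≡y))
    ... | inj₁ S₂ba = ¬separates-same-pair S₁ (T₂.separates-sym S₂ba) a∈R b∈R
    ... | inj₂ S₂bx with T₁.separates-split S₁ a∈R b∈R x∈R (λ x≡y → y≢x (sym x≡y))
    ...   | inj₁ S₁xa = ¬separates-same-pair S₁xa (T₂.separates-sym S₂) x∈R a∈R
    ...   | inj₂ S₁xb = ¬separates-same-pair S₁xb (T₂.separates-sym S₂bx) x∈R b∈R

    ¬separates-in-both : ∀ {y a b c d} → Separates T₁ y a b → Separates T₂ y c d →
                         a ∈ˢ R → b ∈ˢ R → c ∈ˢ R → d ∈ˢ R → ⊥
    ¬separates-in-both S₁@(y≢a , _ , _) S₂ a∈R b∈R c∈R d∈R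
      with T₂.separates-split S₂ c∈R d∈R a∈R (λ a≡y → y≢a (sym a≡y))
    ... | inj₁ S₂ac = ¬separates-shared-end S₁ S₂ac a∈R b∈R c∈R
    ... | inj₂ S₂ad = ¬separates-shared-end S₁ S₂ad a∈R b∈R d∈R

module RootedTree {G : Graph} {R : Subset (Graph.n G)} (T : SteinerTree G R)
                  {r : Fin (Graph.n G)} (r∈R : r ∈ˢ R) where
  open Graph G
  open Walks ends
  open Separation {G} {R}
  open InTree T

  route : ∀ {t} → t ∈ˢ R → Walk ends (treeEdges T) t r
  route t∈R = treePath t∈R r∈R

  routeEdges : Fin n → List (Fin m)
  routeEdges t with t ∈? R
  ... | yes t∈R = edgesOf ends (route t∈R)
  ... | no _ = []

  routeEdges≡ : ∀ {t} (t∈R : t ∈ˢ R) → routeEdges t ≡ edgesOf ends (route t∈R)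
  routeEdges≡ {t} t∈R with t ∈? R
  ... | yes t∈R′ = cong (λ p → edgesOf ends (route p)) (∈-irrelevant t∈R′ t∈R)
  ... | no t∉R = ⊥-elim (t∉R t∈R)

  -- Searching only the edges of terminal-to-root paths is what makes core-separates hold.
  OnRoute : Fin m → Set
  OnRoute e = ∃ λ t → e ∈ routeEdges t

  onRoute? : ∀ e → Dec (OnRoute e)
  onRoute? e = any? λ t → DecMembership._∈?_ _≟_ e (routeEdges t)

  onRoute⁺ : ∀ {t e} (t∈R : t ∈ˢ R) → e ∈ edgesOf ends (route t∈R) → OnRoute e
  onRoute⁺ {t} t∈R m = t , subst (_ ∈_) (sym (routeEdges≡ t∈R)) m

  onRoute⁻ : ∀ {e} → OnRoute e → Σ (Fin n) λ t → Σ (t ∈ˢ R) λ t∈R → e ∈ edgesOf ends (route t∈R)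
  onRoute⁻ (t , m) with t ∈? R
  ... | yes t∈R = t , t∈R , m

  onRoute⇒treeEdge : ∀ {e} → OnRoute e → treeEdges T e
  onRoute⇒treeEdge o with onRoute⁻ o
  ... | _ , t∈R , m = edge∈walk⇒S (route t∈R) m

  routeBound : ℕ
  routeBound = maxOver (λ t → length (routeEdges t))

  open BreadthFirst ends onRoute? (_≟ r) routeBound public
    renaming (dist to rank)

  Core : Fin n → Set
  Core = Reaches routeBound

  core? : ∀ y → Dec (Core y)
  core? = reaches? routeBound

  rank≤routeBound : ∀ {y} → Core y → rank y ≤ routeBound
  rank≤routeBound = dist-min

  terminal-core : ∀ {t} → t ∈ˢ R → Core t
  terminal-core {t} t∈R = reaches-mono length≤bound (walk-reaches routeWalk refl)
    where
    routeWalk : Walk ends OnRoute t r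
    routeWalk = restrictʷ (route t∈R) (onRoute⁺ t∈R)
    length≤bound : length (edgesOf ends routeWalk) ≤ routeBound
    length≤bound = ≤-trans
      (≤-reflexive (trans (length-restrictʷ (route t∈R) (onRoute⁺ t∈R)) (cong length (sym (routeEdges≡ t∈R)))))
      (≤-maxOver (λ t → length (routeEdges t)) t)

  ∉R⇒≢r : ∀ {y} → y ∉ˢ R → y ≢ r
  ∉R⇒≢r y∉R refl = y∉R r∈R

  core-separates : ∀ {y} → Core y → y ∉ˢ R → Σ (Fin n) λ t → t ∈ˢ R × Separates T y t r
  core-separates {y} c y∉R with parentEdge c (∉R⇒≢r y∉R)
  ... | step with onRoute⁻ (ChosenStep.inS step)
  ...   | t , t∈R , e∈route =
    t , t∈R , path-separates (route t∈R) (treePath-isPath t∈R r∈R)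
                (endpoint∈verts (route t∈R) e∈route (ChosenStep.joins step))
                (λ { refl → y∉R t∈R }) (∉R⇒≢r y∉R)

  infix 4 _↝_
  data _↝_ : Fin n → Fin n → Set where
    stay : ∀ {y} → y ↝ y
    move : ∀ {y z} (c : Core y) (y≢r : y ≢ r) → next y ↝ z → y ↝ z

  ↝-rank≤ : ∀ {y z} → y ↝ z → rank z ≤ rank y
  ↝-rank≤ stay = ≤-refl
  ↝-rank≤ (move c y≢r p) = <⇒≤ (≤-<-trans (↝-rank≤ p) (dist-next c y≢r))

  ↝-rank< : ∀ {y z} → y ↝ z → z ≢ y → rank z < rank y
  ↝-rank< stay z≢y = ⊥-elim (z≢y refl)
  ↝-rank< (move c y≢r p) _ = ≤-<-trans (↝-rank≤ p) (dist-next c y≢r)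

  core↝root : ∀ {y} → Core y → y ↝ r
  core↝root c = go _ ≤-refl c
    where
    go : ∀ k {y} → rank y ≤ k → Core y → y ↝ r
    go k {y} _ c with y ≟ r
    ... | yes refl = stay
    go zero {y} rank≤0 c | no y≢r = ⊥-elim (n≮0 (<-≤-trans (pred-dist< c y≢r) rank≤0))
    go (suc k) {y} rank≤k c | no y≢r =
      move c y≢r (go k (≤-pred (≤-trans (dist-next c y≢r) rank≤k)) (next-reaches c y≢r))

  ↝-walk : ∀ {y z} → y ↝ z → Walk ends (treeEdges T) y z
  ↝-walk stay = nil _
  ↝-walk (move c y≢r p) = cons _ (ChosenStep.joins step) (onRoute⇒treeEdge (ChosenStep.inS step)) (↝-walk p)
    where step = parentEdge c y≢r

  ↝-walk-verts : ∀ {y z x} (p : y ↝ z) → x ∈ verts ends (↝-walk p) → y ↝ x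
  ↝-walk-verts stay (here refl) = stay
  ↝-walk-verts (move c y≢r p) (here refl) = stay
  ↝-walk-verts (move c y≢r p) (there m) = move c y≢r (↝-walk-verts p m)

  ↝-walk-isPath : ∀ {y z} (p : y ↝ z) → IsPath ends (↝-walk p)
  ↝-walk-isPath stay = [] ∷ []
  ↝-walk-isPath (move c y≢r p) = ¬Any⇒All¬ _ y∉ ∷ ↝-walk-isPath p
    where
    y∉ : _ → ⊥
    y∉ m = <-irrefl refl (≤-<-trans (↝-rank≤ (↝-walk-verts p m)) (dist-next c y≢r))

  ↝-on-walk : ∀ {y x} (p : y ↝ r) → y ↝ x → x ∈ verts ends (↝-walk p)
  ↝-on-walk p stay = start∈verts (↝-walk p)
  ↝-on-walk stay (move c y≢r q) = ⊥-elim (y≢r refl)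
  ↝-on-walk (move _ _ p) (move _ _ q) = there (↝-on-walk p q)

  ↝-separates : ∀ {t x} → Core t → t ↝ x → x ≢ t → x ≢ r → Separates T x t r
  ↝-separates c t↝x x≢t x≢r = path-separates (↝-walk p) (↝-walk-isPath p) (↝-on-walk p t↝x) x≢t x≢r
    where p = core↝root c

  separates-rank< : ∀ {y u} → Core u → Separates T y u r → rank y < rank u
  separates-rank< c (y≢u , _ , on-all) = ↝-rank< (↝-walk-verts p (on-all (↝-walk p))) y≢u
    where p = core↝root c

  rank-root : rank r ≡ 0
  rank-root = n≤0⇒n≡0 (dist-min refl)

  rank-positive : ∀ {y} → Core y → y ≢ r → 0 < rank y
  rank-positive c y≢r = ≤-<-trans z≤n (pred-dist< c y≢r)

  private
    score : Fin n → ℕ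
    score y with y ∈? R
    ... | yes _ = rank y
    ... | no _ = 0

    score-∈ : ∀ {y} → y ∈ˢ R → score y ≡ rank y
    score-∈ {y} y∈R with y ∈? R
    ... | yes _ = refl
    ... | no y∉R = ⊥-elim (y∉R y∈R)

    score-∉ : ∀ {y} → y ∉ˢ R → score y ≡ 0
    score-∉ {y} y∉R with y ∈? R
    ... | yes y∈R = ⊥-elim (y∉R y∈R)
    ... | no _ = refl

  record NonseparatingTerminal : Set where
    field
      terminal       : Fin n
      terminal∈R     : terminal ∈ˢ R
      terminal≢root  : terminal ≢ r
      separates-none : ∀ {u v} → u ∈ˢ R → v ∈ˢ R → ¬ Separates T terminal u v

  nonseparating-terminal : ∀ {t} → t ∈ˢ R → t ≢ r → NonseparatingTerminal
  nonseparating-terminal {t} t∈R t≢r = record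
    { terminal = s ; terminal∈R = s∈R ; terminal≢root = s≢r ; separates-none = nonseparating }
    where
    s = argmax score r (allFin n)
    score≤ : ∀ u → score u ≤ score s
    score≤ u = All.lookup (f[xs]≤f[argmax] {f = score} r (allFin n)) (∈-allFin u)
    0<score : 0 < score s
    0<score = <-≤-trans (subst (0 <_) (sym (score-∈ t∈R)) (rank-positive (terminal-core t∈R) t≢r)) (score≤ t)
    s∈R : s ∈ˢ R
    s∈R with s ∈? R
    ... | yes s∈R = s∈R
    ... | no s∉R = ⊥-elim (<-irrefl refl (subst (0 <_) (score-∉ s∉R) 0<score))
    s≢r : s ≢ r
    s≢r s≡r = <-irrefl refl (subst (0 <_) (trans (cong score s≡r) (trans (score-∈ r∈R) rank-root)) 0<score)
    rank≤ : ∀ {u} → u ∈ˢ R → rank u ≤ rank s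
    rank≤ {u} u∈R = subst (_≤ rank s) (score-∈ u∈R) (subst (score u ≤_) (score-∈ s∈R) (score≤ u))
    nonseparating : ∀ {u v} → u ∈ˢ R → v ∈ˢ R → ¬ Separates T s u v
    nonseparating {u} {v} u∈R v∈R sep with separates-split sep u∈R v∈R r∈R (λ r≡s → s≢r (sym r≡s))
    ... | inj₁ S = <-irrefl refl (<-≤-trans (separates-rank< (terminal-core u∈R) (separates-sym S)) (rank≤ u∈R))
    ... | inj₂ S = <-irrefl refl (<-≤-trans (separates-rank< (terminal-core v∈R) (separates-sym S)) (rank≤ v∈R))

module HeightedArborescence {V A : Set} (ends : A → V × V) (_≟_ : DecidableEquality V)
  (AS : A → Set) (root : V) (h : V → ℕ)
  (ascending : ∀ {a} → AS a → h (proj₁ (ends a)) < h (proj₂ (ends a)))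
  (in-unique : ∀ {a b} → AS a → AS b → proj₂ (ends a) ≡ proj₂ (ends b) → a ≡ b)
  (parent : ∀ v → v ≢ root → Σ A λ a → AS a × proj₂ (ends a) ≡ v) where

  open Walks ends

  ascending′ : ∀ {a u v} → ends a ≡ (u , v) → AS a → h u < h v
  ascending′ refl s = ascending s

  walk-to-root : ∀ k v → h v ≤ k → Walk ends AS v root
  walk-to-root k v h≤k with v ≟ root
  ... | yes refl = nil root
  ... | no v≢root with parent v v≢root
  ...   | a , s , refl with k
  ...     | zero = ⊥-elim (n≮0 (<-≤-trans (ascending s) h≤k))
  ...     | suc k′ = cons a (inj₂ refl) s (walk-to-root k′ _ (≤-pred (≤-trans (ascending s) h≤k)))

  connected : ∀ u v → Walk ends AS u v
  connected u v = walk-to-root (h u) u ≤-refl ++ʷ reverseʷ (walk-to-root (h v) v ≤-refl)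

  -- Since in-degrees are at most 1, a walk with distinct edges that follows one arc forwards
  -- follows all later arcs forwards, and one that follows an arc backwards followed all
  -- earlier arcs backwards.
  ascending-walk : ∀ {a u x v} → ends a ≡ (u , x) → AS a → (w : Walk ends AS x v) →
                   Unique (a ∷ edgesOf ends w) → h u < h v
  ascending-walk eq s (nil _) _ = ascending′ eq s
  ascending-walk eq s (cons b (inj₁ eqb) sb w) (_ ∷ uniq) =
    <-trans (ascending′ eq s) (ascending-walk eqb sb w uniq)
  ascending-walk eq s (cons b (inj₂ eqb) sb w) uniq = ⊥-elim (
    Unique[x∷xs]⇒x∉xs uniq (here (in-unique s sb (trans (cong proj₂ eq) (sym (cong proj₂ eqb))))))

  descending-walk : ∀ {a b x y v} → Joins ends b x y → AS b → (w : Walk ends AS y v) →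
                    Unique (b ∷ edgesOf ends w) → AS a → proj₂ (ends a) ≡ v → a ∉ b ∷ edgesOf ends w →
                    h v < h x × Σ A λ c → c ∈ b ∷ edgesOf ends w × proj₂ (ends c) ≡ x
  descending-walk (inj₁ eqb) sb (nil _) _ sa head a∉ =
    ⊥-elim (a∉ (here (in-unique sa sb (trans head (sym (cong proj₂ eqb))))))
  descending-walk (inj₂ eqb) sb (nil _) _ _ _ _ = ascending′ eqb sb , _ , here refl , cong proj₂ eqb
  descending-walk jb sb (cons c jc sc w) uniq@(_ ∷ uniq′) sa head a∉
    with descending-walk jc sc w uniq′ sa head (λ m → a∉ (there m))
  ... | hv<hy , c′ , c′∈ , head-c′ with jb
  ...   | inj₁ eqb = ⊥-elim (Unique[x∷xs]⇒x∉xs uniq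
                       (subst (_∈ _) (in-unique sc′ sb (trans head-c′ (sym (cong proj₂ eqb)))) c′∈))
    where sc′ = edge∈walk⇒S (cons c jc sc w) c′∈
  ...   | inj₂ eqb = <-trans hv<hy (ascending′ eqb sb) , _ , here refl , cong proj₂ eqb

  acyclic : ∀ u (c : Walk ends AS u u) → IsCycle ends c → ⊥
  acyclic u (cons a (inj₁ eq) s w) (uniq , _) = <-irrefl refl (ascending-walk eq s w uniq)
  acyclic u (cons a (inj₂ eq) s (nil _)) _ = <-irrefl refl (ascending′ eq s)
  acyclic u (cons a (inj₂ eq) s (cons b jb sb w)) (uniq@(_ ∷ uniq′) , _) =
    <-irrefl refl (<-trans (ascending′ eq s)
      (proj₁ (descending-walk jb sb w uniq′ s (cong proj₂ eq) (Unique[x∷xs]⇒x∉xs uniq))))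

  isTree : IsTree ends (λ _ → ⊤) AS
  isTree = record
    { edgesInside = λ _ _ → tt , tt
    ; nonempty    = root , tt
    ; connected   = λ u v _ _ → connected u v
    ; acyclic     = acyclic
    }

module _ {G : Graph} {R : Subset (Graph.n G)} where
  open Graph G
  open Walks ends

  record Descent : Set where
    field
      next     : Fin n → Fin n
      height   : Fin n → ℕ
      step     : ∀ {y} → y ∉ˢ R → Σ (Fin m) λ e → Joins ends e y (next y)
      descends : ∀ {y} → y ∉ˢ R → height (next y) < height y

  module DescentPartition (D : Descent) where
    open Descent D

    descend : ℕ → Fin n → Fin n
    descend zero y = y
    descend (suc k) y with y ∈? R
    ... | yes _ = y
    ... | no _ = descend k (next y)

    root : Fin n → Fin n
    root y = descend (height y) y

    descend-terminal : ∀ k {t} → t ∈ˢ R → descend k t ≡ t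
    descend-terminal zero t∈R = refl
    descend-terminal (suc k) {t} t∈R with t ∈? R
    ... | yes _ = refl
    ... | no t∉R = ⊥-elim (t∉R t∈R)

    descend-next : ∀ k {y} → y ∉ˢ R → descend (suc k) y ≡ descend k (next y)
    descend-next k {y} y∉R with y ∈? R
    ... | yes y∈R = ⊥-elim (y∉R y∈R)
    ... | no _ = refl

    height0-terminal : ∀ {y} → height y ≤ 0 → y ∈ˢ R
    height0-terminal {y} h≤0 with y ∈? R
    ... | yes y∈R = y∈R
    ... | no y∉R = ⊥-elim (n≮0 (<-≤-trans (descends y∉R) h≤0))

    descend-stable : ∀ k k′ {y} → height y ≤ k → height y ≤ k′ → descend k y ≡ descend k′ y
    descend-stable zero k′ h≤0 _ = sym (descend-terminal k′ (height0-terminal h≤0))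
    descend-stable (suc k) zero _ h≤0 = descend-terminal (suc k) (height0-terminal h≤0)
    descend-stable (suc k) (suc k′) {y} h≤k h≤k′ with y ∈? R
    ... | yes _ = refl
    ... | no y∉R = descend-stable k k′ (≤-pred (≤-trans (descends y∉R) h≤k))
                                       (≤-pred (≤-trans (descends y∉R) h≤k′))

    descend-∈ : ∀ k {y} → height y ≤ k → descend k y ∈ˢ R
    descend-∈ zero h≤0 = height0-terminal h≤0
    descend-∈ (suc k) {y} h≤k with y ∈? R
    ... | yes y∈R = y∈R
    ... | no y∉R = descend-∈ k (≤-pred (≤-trans (descends y∉R) h≤k))

    root-∈ : ∀ y → root y ∈ˢ R
    root-∈ y = descend-∈ (height y) ≤-refl

    root-terminal : ∀ {t} → t ∈ˢ R → root t ≡ t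
    root-terminal {t} t∈R = descend-terminal (height t) t∈R

    root-next : ∀ {y} → y ∉ˢ R → root (next y) ≡ root y
    root-next {y} y∉R = begin
      descend (height (next y)) (next y)  ≡⟨ descend-stable _ _ ≤-refl (<⇒≤pred (descends y∉R)) ⟩
      descend (pred (height y)) (next y)  ≡⟨ sym (descend-next _ y∉R) ⟩
      descend (suc (pred (height y))) y   ≡⟨ cong (λ k → descend k y) (suc-pred (height y) {{>-nonZero (m<n⇒0<n (descends y∉R))}}) ⟩
      descend (height y) y                ∎
      where open ≡-Reasoning

    part : Fin n → Fin ∣ R ∣
    part y = index (root-∈ y)

    part-terminal : ∀ {t} (t∈R : t ∈ˢ R) → part t ≡ index t∈R
    part-terminal t∈R = index-cong (root-terminal t∈R) (root-∈ _) t∈R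

    element-part : ∀ y → element R (part y) ≡ root y
    element-part y = element-index (root-∈ y)

    part-injective : ∀ {t u} → t ∈ˢ R → u ∈ˢ R → part t ≡ part u → t ≡ u
    part-injective t∈R u∈R eq =
      index-injective t∈R u∈R (trans (sym (part-terminal t∈R)) (trans eq (part-terminal u∈R)))

    SameRoot : Fin n → Fin m → Set
    SameRoot t e = root (proj₁ (ends e)) ≡ t × root (proj₂ (ends e)) ≡ t

    joins-sameRoot : ∀ {e a b t} → Joins ends e a b → root a ≡ t → root b ≡ t → SameRoot t e
    joins-sameRoot (inj₁ refl) ra rb = ra , rb
    joins-sameRoot (inj₂ refl) ra rb = rb , ra

    walk-to-root : ∀ k y → height y ≤ k → Walk ends (SameRoot (root y)) y (root y)
    walk-to-root k y h≤k with y ∈? R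
    ... | yes y∈R rewrite root-terminal y∈R = nil y
    ... | no y∉R with k | step y∉R
    ...   | zero | _ = ⊥-elim (n≮0 (<-≤-trans (descends y∉R) h≤k))
    ...   | suc k′ | e , j rewrite sym (root-next y∉R) =
      cons e j (joins-sameRoot j (sym (root-next y∉R)) refl)
        (walk-to-root k′ (next y) (≤-pred (≤-trans (descends y∉R) h≤k)))

    partConnected : ∀ u v → part u ≡ part v →
      Walk ends (λ e → part (proj₁ (ends e)) ≡ part u × part (proj₂ (ends e)) ≡ part u) u v
    partConnected u v eq = mapʷ toPart (walk-to-root _ u ≤-refl ++ʷ reverseʷ v-to-root)
      where
      ru≡rv : root u ≡ root v
      ru≡rv = index-injective (root-∈ u) (root-∈ v) eq
      v-to-root : Walk ends (SameRoot (root u)) v (root u)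
      v-to-root = subst (λ t → Walk ends (SameRoot t) v t) (sym ru≡rv) (walk-to-root _ v ≤-refl)
      toPart : ∀ {e} → SameRoot (root u) e →
               part (proj₁ (ends e)) ≡ part u × part (proj₂ (ends e)) ≡ part u
      toPart (r₁ , r₂) = index-cong r₁ (root-∈ _) (root-∈ u) , index-cong r₂ (root-∈ _) (root-∈ u)

    partition : RPartition G R
    partition = record
      { k             = ∣ R ∣
      ; part          = part
      ; oneTerminal   = λ i → element R i , element-∈ R i , part-element i ,
                              λ t t∈R eq → part-injective t∈R (element-∈ R i) (trans eq (sym (part-element i)))
      ; partConnected = partConnected
      }
      where
      part-element : ∀ i → part (element R i) ≡ i
      part-element i = trans (part-terminal (element-∈ R i)) (index-element R i)

joins-distinct : ∀ {G : Graph} → let open Graph G in ∀ {e t x} → Joins ends e t x → t ≢ x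
joins-distinct {G} {e} (inj₁ eq) t≡x =
  Graph.noLoop G e (trans (cong proj₁ eq) (trans t≡x (sym (cong proj₂ eq))))
joins-distinct {G} {e} (inj₂ eq) t≡x =
  Graph.noLoop G e (trans (cong proj₁ eq) (trans (sym t≡x) (sym (cong proj₂ eq))))

module ArcOrientation {G : Graph} {R : Subset (Graph.n G)} (P : RPartition G R) where
  open Graph G

  toward : ∀ {e t x} → Joins ends e t x → Bool
  toward (inj₁ _) = false
  toward (inj₂ _) = true

  tgtV-toward : ∀ {e t x} (j : Joins ends e t x) → tgtV G P (e , toward j) ≡ t
  tgtV-toward (inj₁ eq) = cong proj₁ eq
  tgtV-toward (inj₂ eq) = cong proj₂ eq

  src-of-joins : ∀ {e t x} d → Joins ends e t x → tgtV G P (e , d) ≡ t → src G P (e , d) ≡ x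
  src-of-joins {e} true (inj₁ eq) tgt≡t = ⊥-elim (noLoop e (trans (cong proj₁ eq) (sym tgt≡t)))
  src-of-joins true (inj₂ eq) _ = cong proj₁ eq
  src-of-joins false (inj₁ eq) _ = cong proj₂ eq
  src-of-joins {e} false (inj₂ eq) tgt≡t = ⊥-elim (noLoop e (trans tgt≡t (sym (cong proj₂ eq))))

  orientation-unique : ∀ e d d′ → tgtV G P (e , d) ≡ tgtV G P (e , d′) → d ≡ d′
  orientation-unique e true true _ = refl
  orientation-unique e false false _ = refl
  orientation-unique e true false eq = ⊥-elim (noLoop e (sym eq))
  orientation-unique e false true eq = ⊥-elim (noLoop e eq)

module Construction {G : Graph} {R : Subset (Graph.n G)} (C : CIST2 G R)
  {r₁ r₂ : Fin (Graph.n G)} (r₁∈R : r₁ ∈ˢ R) (r₂∈R : r₂ ∈ˢ R) (r₂≢r₁ : r₂ ≢ r₁)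
  (r₁-separates-none-in-T₂ : ∀ {u v} → u ∈ˢ R → v ∈ˢ R → ¬ Separation.Separates (CIST2.T₂ C) r₁ u v)
  (r₂-separates-none-in-T₁ : ∀ {u v} → u ∈ˢ R → v ∈ˢ R → ¬ Separation.Separates (CIST2.T₁ C) r₂ u v)
  where
  open Graph G
  open Walks ends
  open Separation {G} {R}
  open CIST2 C

  module Tree₁ = RootedTree T₁ r₁∈R
  module Tree₂ = RootedTree T₂ r₂∈R

  no-common-core : ∀ {y} → y ∉ˢ R → Tree₁.Core y → Tree₂.Core y → ⊥
  no-common-core y∉R c₁ c₂ =
    let (t , t∈R , S₁) = Tree₁.core-separates c₁ y∉R
        (u , u∈R , S₂) = Tree₂.core-separates c₂ y∉R
    in ¬separates-in-both C S₁ S₂ t∈R r₁∈R u∈R r₂∈R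

  Target : Fin n → Set
  Target y = y ∈ˢ R ⊎ Tree₁.Core y ⊎ Tree₂.Core y

  private
    target? : ∀ y → Dec (Target y)
    target? y = y ∈? R ⊎-dec Tree₁.core? y ⊎-dec Tree₂.core? y

    outerBound : ℕ
    outerBound = maxOver (λ y → length (edgesOf ends (conn y r₁)))

  module Outer = BreadthFirst ends (λ _ → yes tt) target? outerBound

  outer-reaches : ∀ y → Outer.Reaches outerBound y
  outer-reaches y = Outer.reaches-mono (≤-maxOver (λ y → length (edgesOf ends (conn y r₁))) y)
                                       (Outer.walk-reaches (conn y r₁) (inj₁ r₁∈R))

  data Class (y : Fin n) : Set where
    terminal : y ∈ˢ R → Class y
    core₁    : y ∉ˢ R → Tree₁.Core y → Class y
    core₂    : y ∉ˢ R → ¬ Tree₁.Core y → Tree₂.Core y → Class y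
    outer    : y ∉ˢ R → ¬ Tree₁.Core y → ¬ Tree₂.Core y → Class y

  classify : ∀ y → Class y
  classify y = by-decisions (y ∈? R) (Tree₁.core? y) (Tree₂.core? y)
    where
    by-decisions : Dec (y ∈ˢ R) → Dec (Tree₁.Core y) → Dec (Tree₂.Core y) → Class y
    by-decisions (yes y∈R) _ _ = terminal y∈R
    by-decisions (no y∉R) (yes c₁) _ = core₁ y∉R c₁
    by-decisions (no y∉R) (no ¬c₁) (yes c₂) = core₂ y∉R ¬c₁ c₂
    by-decisions (no y∉R) (no ¬c₁) (no ¬c₂) = outer y∉R ¬c₁ ¬c₂

  not-target : ∀ {y} → y ∉ˢ R → ¬ Tree₁.Core y → ¬ Tree₂.Core y → ¬ Target y
  not-target y∉R _ _ (inj₁ y∈R) = y∉R y∈R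
  not-target _ ¬c₁ _ (inj₂ (inj₁ c₁)) = ¬c₁ c₁
  not-target _ _ ¬c₂ (inj₂ (inj₂ c₂)) = ¬c₂ c₂

  -- Outer vertices are placed above every core rank, so stepping into a core descends.
  coreBound : ℕ
  coreBound = suc (Tree₁.routeBound + Tree₂.routeBound)

  nextOf : ∀ {y} → Class y → Fin n
  nextOf {y} (terminal _) = y
  nextOf {y} (core₁ _ _) = Tree₁.next y
  nextOf {y} (core₂ _ _ _) = Tree₂.next y
  nextOf {y} (outer _ _ _) = Outer.next y

  heightOf : ∀ {y} → Class y → ℕ
  heightOf (terminal _) = 0
  heightOf {y} (core₁ _ _) = Tree₁.rank y
  heightOf {y} (core₂ _ _ _) = Tree₂.rank y
  heightOf {y} (outer _ _ _) = coreBound + Outer.dist y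

  private
    core₁-descends : ∀ {y} → y ∉ˢ R → (c : Tree₁.Core y) → (k : Class (Tree₁.next y)) →
                     heightOf k < Tree₁.rank y
    core₁-descends y∉R c (terminal _) = Tree₁.rank-positive c (Tree₁.∉R⇒≢r y∉R)
    core₁-descends y∉R c (core₁ _ _) = Tree₁.dist-next c (Tree₁.∉R⇒≢r y∉R)
    core₁-descends y∉R c (core₂ _ ¬c₁ _) = ⊥-elim (¬c₁ (Tree₁.next-reaches c (Tree₁.∉R⇒≢r y∉R)))
    core₁-descends y∉R c (outer _ ¬c₁ _) = ⊥-elim (¬c₁ (Tree₁.next-reaches c (Tree₁.∉R⇒≢r y∉R)))

    core₂-descends : ∀ {y} → y ∉ˢ R → (c : Tree₂.Core y) → (k : Class (Tree₂.next y)) →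
                     heightOf k < Tree₂.rank y
    core₂-descends y∉R c (terminal _) = Tree₂.rank-positive c (Tree₂.∉R⇒≢r y∉R)
    core₂-descends y∉R c (core₁ z∉R c₁) =
      ⊥-elim (no-common-core z∉R c₁ (Tree₂.next-reaches c (Tree₂.∉R⇒≢r y∉R)))
    core₂-descends y∉R c (core₂ _ _ _) = Tree₂.dist-next c (Tree₂.∉R⇒≢r y∉R)
    core₂-descends y∉R c (outer _ _ ¬c₂) = ⊥-elim (¬c₂ (Tree₂.next-reaches c (Tree₂.∉R⇒≢r y∉R)))

    outer-descends : ∀ {y} → ¬ Target y → (k : Class (Outer.next y)) →
                     heightOf k < coreBound + Outer.dist y
    outer-descends ¬t (terminal _) = s≤s z≤n
    outer-descends ¬t (core₁ _ c) =
      <-≤-trans (s≤s (≤-trans (Tree₁.rank≤routeBound c) (m≤m+n _ _))) (m≤m+n coreBound _)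
    outer-descends ¬t (core₂ _ _ c) =
      <-≤-trans (s≤s (≤-trans (Tree₂.rank≤routeBound c) (m≤n+m _ _))) (m≤m+n coreBound _)
    outer-descends {y} ¬t (outer _ _ _) = +-monoʳ-< coreBound (Outer.dist-next (outer-reaches y) ¬t)

    stepOf : ∀ {y} → y ∉ˢ R → (k : Class y) → Σ (Fin m) λ e → Joins ends e y (nextOf k)
    stepOf y∉R (terminal y∈R) = ⊥-elim (y∉R y∈R)
    stepOf _ (core₁ y∉R c) =
      let open BreadthFirst.ChosenStep (Tree₁.parentEdge c (Tree₁.∉R⇒≢r y∉R)) in edge , joins
    stepOf _ (core₂ y∉R _ c) =
      let open BreadthFirst.ChosenStep (Tree₂.parentEdge c (Tree₂.∉R⇒≢r y∉R)) in edge , joins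
    stepOf {y} _ (outer y∉R ¬c₁ ¬c₂) =
      let open BreadthFirst.ChosenStep (Outer.parentEdge (outer-reaches y) (not-target y∉R ¬c₁ ¬c₂))
      in edge , joins

    descendsOf : ∀ {y} → y ∉ˢ R → (k : Class y) → heightOf (classify (nextOf k)) < heightOf k
    descendsOf y∉R (terminal y∈R) = ⊥-elim (y∉R y∈R)
    descendsOf _ (core₁ y∉R c) = core₁-descends y∉R c (classify _)
    descendsOf _ (core₂ y∉R _ c) = core₂-descends y∉R c (classify _)
    descendsOf _ (outer y∉R ¬c₁ ¬c₂) = outer-descends (not-target y∉R ¬c₁ ¬c₂) (classify _)

  descent : Descent {G} {R}
  descent = record
    { next     = λ y → nextOf (classify y)
    ; height   = λ y → heightOf (classify y)
    ; step     = λ {y} y∉R → stepOf y∉R (classify y)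
    ; descends = λ {y} y∉R → descendsOf y∉R (classify y)
    }

  open Descent descent public using (next; height; descends)
  open DescentPartition descent public

  next-agrees₁ : ∀ {y} → y ∉ˢ R → Tree₁.Core y → next y ≡ Tree₁.next y
  next-agrees₁ {y} y∉R c = agrees (classify y)
    where
    agrees : (k : Class y) → nextOf k ≡ Tree₁.next y
    agrees (terminal y∈R) = ⊥-elim (y∉R y∈R)
    agrees (core₁ _ _) = refl
    agrees (core₂ _ ¬c₁ _) = ⊥-elim (¬c₁ c)
    agrees (outer _ ¬c₁ _) = ⊥-elim (¬c₁ c)

  next-agrees₂ : ∀ {y} → y ∉ˢ R → Tree₂.Core y → next y ≡ Tree₂.next y
  next-agrees₂ {y} y∉R c = agrees (classify y)
    where
    agrees : (k : Class y) → nextOf k ≡ Tree₂.next y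
    agrees (terminal y∈R) = ⊥-elim (y∉R y∈R)
    agrees (core₁ _ c₁) = ⊥-elim (no-common-core y∉R c₁ c)
    agrees (core₂ _ _ _) = refl
    agrees (outer _ _ ¬c₂) = ⊥-elim (¬c₂ c)

  Arcᴾ : Set
  Arcᴾ = Arc G partition

  srcᴾ tgtᴾ : Arcᴾ → Fin n
  srcᴾ = src G partition
  tgtᴾ = tgtV G partition

  module TreeArborescence (T : SteinerTree G R) {r : Fin n} (r∈R : r ∈ˢ R)
    (agrees : ∀ {y} → y ∉ˢ R → RootedTree.Core T r∈R y → next y ≡ RootedTree.next T r∈R y) where

    module Tr = RootedTree T r∈R
    open ArcOrientation partition
    open Tr using (_↝_; stay; move)

    ↝-root : ∀ {x} → Tr.Core x → x ↝ root x
    ↝-root {x} c = go (height x) ≤-refl c (x ∈? R)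
      where
      go : ∀ k {x} → height x ≤ k → Tr.Core x → Dec (x ∈ˢ R) → x ↝ root x
      go _ _ _ (yes x∈R) = subst (_ ↝_) (sym (root-terminal x∈R)) stay
      go zero h≤0 _ (no x∉R) = ⊥-elim (x∉R (height0-terminal h≤0))
      go (suc k) {x} h≤k c (no x∉R) =
        move c x≢r (subst₂ _↝_ (agrees x∉R c) (root-next x∉R)
          (go k (≤-pred (≤-trans (descends x∉R) h≤k))
                (subst Tr.Core (sym (agrees x∉R c)) (Tr.next-reaches c x≢r)) (next x ∈? R)))
        where x≢r = Tr.∉R⇒≢r x∉R

    InTree : Arcᴾ → Set
    InTree a = Σ (Fin n) λ t → t ∈ˢ R × t ≢ r × Tr.nextEdge t ≡ just (proj₁ a) × tgtᴾ a ≡ t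

    parentStep : ∀ {t} → t ∈ˢ R → t ≢ r → BreadthFirst.ChosenStep _ _ _ _ (Tr.parent? t)
    parentStep t∈R t≢r = Tr.parentEdge (Tr.terminal-core t∈R) t≢r

    record TreeArc (a : Arcᴾ) : Set where
      field
        head      : Fin n
        head∈R    : head ∈ˢ R
        head≢root : head ≢ r
        tgt≡      : tgtᴾ a ≡ head
        src≡      : srcᴾ a ≡ Tr.next head
        joins     : Joins ends (proj₁ a) head (Tr.next head)
        treeEdge  : Separation.treeEdges T (proj₁ a)

    treeArc : ∀ {a} → InTree a → TreeArc a
    treeArc {e , d} (t , t∈R , t≢r , nextEdge≡ , tgt≡) = record
      { head = t ; head∈R = t∈R ; head≢root = t≢r ; tgt≡ = tgt≡
      ; src≡ = src-of-joins d e-joins tgt≡ ; joins = e-joins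
      ; treeEdge = Tr.onRoute⇒treeEdge (subst Tr.OnRoute edge≡ (ChosenStep.inS step)) }
      where
      open BreadthFirst using (module ChosenStep)
      step = parentStep t∈R t≢r
      edge≡ : ChosenStep.edge step ≡ e
      edge≡ = just-injective (trans (sym (ChosenStep.chosenEdge≡ step)) nextEdge≡)
      e-joins : Joins ends e t (Tr.next t)
      e-joins = subst (λ e → Joins ends e t (Tr.next t)) edge≡ (ChosenStep.joins step)

    partHeight : Fin ∣ R ∣ → ℕ
    partHeight i = Tr.rank (element R i)

    partHeight-part : ∀ y → partHeight (part y) ≡ Tr.rank (root y)
    partHeight-part y = cong Tr.rank (element-part y)

    root-next-rank< : ∀ {t} → t ∈ˢ R → t ≢ r → Tr.rank (root (Tr.next t)) < Tr.rank t
    root-next-rank< t∈R t≢r = ≤-<-trans (Tr.↝-rank≤ (↝-root (Tr.next-reaches c t≢r))) (Tr.dist-next c t≢r)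
      where c = Tr.terminal-core t∈R

    ascending : ∀ {a} → InTree a → partHeight (part (srcᴾ a)) < partHeight (part (tgtᴾ a))
    ascending {a} a∈T = begin-strict
      partHeight (part (srcᴾ a))  ≡⟨ partHeight-part (srcᴾ a) ⟩
      Tr.rank (root (srcᴾ a))     ≡⟨ cong (λ y → Tr.rank (root y)) src≡ ⟩
      Tr.rank (root (Tr.next t))  <⟨ root-next-rank< head∈R head≢root ⟩
      Tr.rank t                   ≡⟨ cong Tr.rank (sym (trans (cong root tgt≡) (root-terminal head∈R))) ⟩
      Tr.rank (root (tgtᴾ a))     ≡⟨ sym (partHeight-part (tgtᴾ a)) ⟩
      partHeight (part (tgtᴾ a))  ∎
      where
      open ≤-Reasoning
      open TreeArc (treeArc {a} a∈T) renaming (head to t)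

    in-unique : ∀ {a b} → InTree a → InTree b → part (tgtᴾ a) ≡ part (tgtᴾ b) → a ≡ b
    in-unique {e , d} {e′ , d′} (t , t∈R , _ , nextEdge≡ , tgt≡) (t′ , t′∈R , _ , nextEdge≡′ , tgt≡′) eq =
      cong₂ _,_ e≡e′ (orientation-unique e′ d d′ (trans (cong (λ e → tgtᴾ (e , d)) (sym e≡e′))
                                                  (trans tgt≡ (trans t≡t′ (sym tgt≡′)))))
      where
      t≡t′ : t ≡ t′
      t≡t′ = part-injective t∈R t′∈R (trans (cong part (sym tgt≡)) (trans eq (cong part tgt≡′)))
      e≡e′ : e ≡ e′
      e≡e′ = just-injective (trans (sym nextEdge≡) (trans (cong Tr.nextEdge t≡t′) nextEdge≡′))

    parent : ∀ v → v ≢ part r → Σ Arcᴾ λ a → InTree a × part (tgtᴾ a) ≡ v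
    parent v v≢root = (e , toward j) , (t , t∈R , t≢r , chosenEdge≡ , tgtV-toward j) , part-tgt
      where
      open BreadthFirst using (module ChosenStep)
      t = element R v
      t∈R = element-∈ R v
      part-t : part t ≡ v
      part-t = trans (part-terminal t∈R) (index-element R v)
      t≢r : t ≢ r
      t≢r t≡r = v≢root (trans (sym part-t) (cong part t≡r))
      open ChosenStep (parentStep t∈R t≢r) renaming (edge to e; joins to j)
      part-tgt : part (tgtᴾ (e , toward j)) ≡ v
      part-tgt = trans (cong part (tgtV-toward j)) part-t

    arborescence : Arborescence G partition
    arborescence = record
      { AS      = InTree
      ; arcs    = λ a a∈T → (λ eq → <-irrefl (cong partHeight eq) (ascending {a} a∈T)) ,
                            subst (_∈ˢ R) (sym (TreeArc.tgt≡ (treeArc {a} a∈T))) (TreeArc.head∈R (treeArc {a} a∈T))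
      ; isTree  = HeightedArborescence.isTree (arcEnds G partition) _≟_ InTree (part r) partHeight
                    (λ {a} → ascending {a}) (λ {a} {b} → in-unique {a} {b}) parent
      ; root    = part r
      ; rootIn0 = λ a a∈T eq → let open TreeArc (treeArc {a} a∈T) in
                    head≢root (part-injective head∈R r∈R (trans (cong part (sym tgt≡)) eq))
      ; inDeg1  = parent
      ; inDeg≤1 = λ a b → in-unique {a} {b}
      }

    out-arc : ∀ {v} → DegAtLeast2 (arcEnds G partition) InTree v →
              Σ Arcᴾ λ a → InTree a × part (srcᴾ a) ≡ v
    out-arc (a , b , a≢b , a∈T , b∈T , (_ , inj₁ ends-a) , _) = a , a∈T , cong proj₁ ends-a
    out-arc (a , b , a≢b , a∈T , b∈T , (_ , inj₂ ends-a) , (_ , inj₁ ends-b)) = b , b∈T , cong proj₁ ends-b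
    out-arc (a , b , a≢b , a∈T , b∈T , (_ , inj₂ ends-a) , (_ , inj₂ ends-b)) =
      ⊥-elim (a≢b (in-unique {a} {b} a∈T b∈T (trans (cong proj₂ ends-a) (sym (cong proj₂ ends-b)))))

    interior-separates : ∀ {v} → DegAtLeast2 (arcEnds G partition) InTree v → element R v ≢ r →
                         Σ (Fin n) λ t → t ∈ˢ R × Separates T (element R v) t r
    interior-separates {v} deg τ≢r =
      t , head∈R , Tr.↝-separates c t↝τ τ≢t τ≢r
      where
      a = proj₁ (out-arc deg)
      open TreeArc (treeArc {a} (proj₁ (proj₂ (out-arc deg)))) renaming (head to t)
      c = Tr.terminal-core head∈R
      τ≡ : element R v ≡ root (Tr.next t)
      τ≡ = trans (cong (element R) (sym (proj₂ (proj₂ (out-arc deg))))) (trans (element-part (srcᴾ a)) (cong root src≡))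
      t↝τ : t ↝ element R v
      t↝τ = subst (t ↝_) (sym τ≡) (move c head≢root (↝-root (Tr.next-reaches c head≢root)))
      τ≢t : element R v ≢ t
      τ≢t τ≡t = <-irrefl (cong Tr.rank (trans (sym τ≡) τ≡t)) (root-next-rank< head∈R head≢root)

  module Arb₁ = TreeArborescence T₁ r₁∈R next-agrees₁
  module Arb₂ = TreeArborescence T₂ r₂∈R next-agrees₂

  arcs-disjoint : ∀ a → Arb₁.InTree a → Arb₂.InTree a → ⊥
  arcs-disjoint a a∈T₁ a∈T₂ = by-source (srcᴾ a ∈? R)
    where
    module A₁ = Arb₁.TreeArc (Arb₁.treeArc {a} a∈T₁)
    module A₂ = Arb₂.TreeArc (Arb₂.treeArc {a} a∈T₂)
    t = A₁.head
    t≡t′ : t ≡ A₂.head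
    t≡t′ = trans (sym A₁.tgt≡) A₂.tgt≡
    by-source : Dec (srcᴾ a ∈ˢ R) → ⊥
    by-source (no x∉R) = no-common-core x∉R
      (subst Tree₁.Core (sym A₁.src≡) (Tree₁.next-reaches (Tree₁.terminal-core A₁.head∈R) A₁.head≢root))
      (subst Tree₂.Core (sym A₂.src≡) (Tree₂.next-reaches (Tree₂.terminal-core A₂.head∈R) A₂.head≢root))
    by-source (yes x∈R) = proj₁ (disj₁₂ t x A₁.head∈R x∈R t≢x P t-x-unique Q t-x-unique) (proj₁ a) (here refl) (here refl)
      where
      x = srcᴾ a
      j₁ : Joins ends (proj₁ a) t x
      j₁ = subst (Joins ends (proj₁ a) t) (sym A₁.src≡) A₁.joins
      j₂ : Joins ends (proj₁ a) t x
      j₂ = subst₂ (Joins ends (proj₁ a)) (sym t≡t′) (sym A₂.src≡) A₂.joins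
      t≢x : t ≢ x
      t≢x = joins-distinct {G} j₁
      P = cons (proj₁ a) j₁ A₁.treeEdge (nil x)
      Q = cons (proj₁ a) j₂ A₂.treeEdge (nil x)
      t-x-unique : Unique (t ∷ x ∷ [])
      t-x-unique = (t≢x ∷ []) ∷ ([] ∷ [])

  interiors-disjoint : ∀ v → DegAtLeast2 (arcEnds G partition) Arb₁.InTree v →
                       DegAtLeast2 (arcEnds G partition) Arb₂.InTree v → ⊥
  interiors-disjoint v deg₁ deg₂ = by-terminal (τ ≟ r₁) (τ ≟ r₂)
    where
    τ = element R v
    by-terminal : Dec (τ ≡ r₁) → Dec (τ ≡ r₂) → ⊥
    by-terminal (yes refl) _ =
      let (t , t∈R , S₂) = Arb₂.interior-separates deg₂ (λ r₁≡r₂ → r₂≢r₁ (sym r₁≡r₂))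
      in r₁-separates-none-in-T₂ t∈R r₂∈R S₂
    by-terminal (no τ≢r₁) (yes refl) =
      let (t , t∈R , S₁) = Arb₁.interior-separates deg₁ τ≢r₁
      in r₂-separates-none-in-T₁ t∈R r₁∈R S₁
    by-terminal (no τ≢r₁) (no τ≢r₂) =
      let (t , t∈R , S₁) = Arb₁.interior-separates deg₁ τ≢r₁
          (u , u∈R , S₂) = Arb₂.interior-separates deg₂ τ≢r₂
      in ¬separates-in-both C S₁ S₂ t∈R r₁∈R u∈R r₂∈R

  cisa : CISA2 G partition
  cisa = record
    { A₁      = Arb₁.arborescence
    ; A₂      = Arb₂.arborescence
    ; arcDisj = arcs-disjoint
    ; intDisj = interiors-disjoint
    }

theorem3p27 : (G : Graph) (R : Subset (Graph.n G)) → ∣ R ∣ ≥ 2 →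
    CIST2 G R → Σ (RPartition G R) λ P → CISA2 G P
theorem3p27 G R two C with two-elements R two
... | a , b , a∈R , b∈R , a≢b = partition , cisa
  where
  open CIST2 C
  module T₂-at-a = RootedTree T₂ a∈R
  open T₂-at-a.NonseparatingTerminal (T₂-at-a.nonseparating-terminal b∈R (λ b≡a → a≢b (sym b≡a)))
    using () renaming (terminal to r₁; terminal∈R to r₁∈R; separates-none to r₁-separates-none-in-T₂)
  module T₁-at-r₁ = RootedTree T₁ r₁∈R
  other = distinct-from a∈R b∈R a≢b r₁
  open T₁-at-r₁.NonseparatingTerminal (T₁-at-r₁.nonseparating-terminal (proj₁ (proj₂ other)) (proj₂ (proj₂ other)))
    using () renaming (terminal to r₂; terminal∈R to r₂∈R; terminal≢root to r₂≢r₁;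
                       separates-none to r₂-separates-none-in-T₁)
  open Construction C r₁∈R r₂∈R r₂≢r₁ r₁-separates-none-in-T₂ r₂-separates-none-in-T₁
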